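{- Let $G$ be a finite simple graph on $n$ vertices. If $G$ contains a matching $M$ such that for each edge $uv\in M$, $u$ and $v$ are adjacent twins, then $r_2(G)=2|M|+r_2(G-V(M))$.
   Context: $r_2(H)$ denotes the rank over $\mathbb{F}_2$ of the adjacency matrix of $H$ (with $r_2$ of the graph with no vertices equal to $0$). Two vertices $u,v$ are adjacent twins if $N[u]=N[v]$, where $N[x]$ is the closed neighborhood of $x$. $V(M)$ is the set of vertices covered by $M$, and $G-V(M)$ is the induced subgraph on the remaining vertices. -}

module Defs where

open import Data.Bool using (Bool; true; false; _∧_; _∨_; _xor_; not; if_then_else_)
open import Data.Nat using (ℕ; zero; suc; _+_; _⊔_)
open import Data.Fin using (Fin; zero; suc; _≟_)
open import Data.List using (List; []; _∷_; _++_; map; foldr; filterᵇ; allFin; length; lookup; concatMap)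
open import Data.Bool.ListAction using (any)
open import Data.List.Relation.Unary.All using (All)
open import Data.List.Relation.Unary.Unique.Propositional using (Unique)
open import Data.Product using (_×_; _,_; proj₁; proj₂)
open import Relation.Nullary.Decidable using (⌊_⌋)
open import Relation.Binary.PropositionalEquality using (_≡_; refl)

Matrix : ℕ → ℕ → Set
Matrix m k = Fin m → Fin k → Bool

sum₂ : {m : ℕ} → (Fin m → Bool) → Bool
sum₂ {zero}  f = false
sum₂ {suc m} f = f zero xor sum₂ (λ i → f (suc i))

allF : {m : ℕ} → (Fin m → Bool) → Bool
allF {zero}  f = true
allF {suc m} f = f zero ∧ allF (λ i → f (suc i))

anyF : {m : ℕ} → (Fin m → Bool) → Bool
anyF {zero}  f = false
anyF {suc m} f = f zero ∨ anyF (λ i → f (suc i))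

SubsetF : ℕ → Set
SubsetF m = Fin m → Bool

allSubsets : (m : ℕ) → List (SubsetF m)
allSubsets zero    = (λ ()) ∷ []
allSubsets (suc m) =
  map (λ S → λ { zero → false ; (suc i) → S i }) (allSubsets m) ++
  map (λ S → λ { zero → true  ; (suc i) → S i }) (allSubsets m)

card : {m : ℕ} → SubsetF m → ℕ
card {zero}  S = 0
card {suc m} S = (if S zero then 1 else 0) + card (λ i → S (suc i))

_⊆ᵇ_ : {m : ℕ} → SubsetF m → SubsetF m → Bool
U ⊆ᵇ T = allF (λ i → not (U i) ∨ T i)

nonempty : {m : ℕ} → SubsetF m → Bool
nonempty U = anyF U

rowSum : {m k : ℕ} → Matrix m k → SubsetF m → Fin k → Bool
rowSum A U c = sum₂ (λ i → U i ∧ A i c)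

isZeroVec : {k : ℕ} → (Fin k → Bool) → Bool
isZeroVec v = allF (λ c → not (v c))

independentRows : {m k : ℕ} → Matrix m k → SubsetF m → Bool
independentRows {m} A T =
  foldr (λ U b → (not (U ⊆ᵇ T ∧ nonempty U) ∨ not (isZeroVec (rowSum A U))) ∧ b)
        true (allSubsets m)

rank₂ : {m k : ℕ} → Matrix m k → ℕ
rank₂ {m} A = foldr _⊔_ 0 (map card (filterᵇ (independentRows A) (allSubsets m)))

record Graph (n : ℕ) : Set where
  field
    adj    : Fin n → Fin n → Bool
    sym    : ∀ u v → adj u v ≡ adj v u
    irrefl : ∀ v → adj v v ≡ false
open Graph public

r₂ : {n : ℕ} → Graph n → ℕ
r₂ G = rank₂ (adj G)

inClosedNbhd : {n : ℕ} → Graph n → Fin n → Fin n → Bool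
inClosedNbhd G u w = ⌊ u ≟ w ⌋ ∨ adj G u w

AdjacentTwins : {n : ℕ} → Graph n → Fin n → Fin n → Set
AdjacentTwins G u v = ∀ w → inClosedNbhd G u w ≡ inClosedNbhd G v w

EdgeList : ℕ → Set
EdgeList n = List (Fin n × Fin n)

coveredVertices : {n : ℕ} → EdgeList n → List (Fin n)
coveredVertices = concatMap (λ e → proj₁ e ∷ proj₂ e ∷ [])

-- M is a matching of G: every pair is an edge of G and the listed
-- endpoints are pairwise distinct (so edges are disjoint, and none repeated).
IsMatching : {n : ℕ} → Graph n → EdgeList n → Set
IsMatching G M = All (λ e → adj G (proj₁ e) (proj₂ e) ≡ true) M × Unique (coveredVertices M)

-- G - X : the subgraph induced on the vertices not in the list X,
-- with the remaining vertices relabelled 0..m-1 in increasing order.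
remaining : {n : ℕ} → List (Fin n) → List (Fin n)
remaining {n} X = filterᵇ (λ v → not (any (λ x → ⌊ v ≟ x ⌋) X)) (allFin n)

deleteVertices : {n : ℕ} → (G : Graph n) → (X : List (Fin n)) → Graph (length (remaining X))
deleteVertices G X = record
  { adj    = λ i j → adj G (lookup (remaining X) i) (lookup (remaining X) j)
  ; sym    = λ i j → sym G (lookup (remaining X) i) (lookup (remaining X) j)
  ; irrefl = λ i → irrefl G (lookup (remaining X) i)
  }

-- Over 𝔽₂ the rows of u and v in the adjacency matrix agree outside
-- the columns u and v, while on {u, v} they form the block [[0,1],[1,0]]. Hence a maximum
-- independent set of rows of the principal submatrix on Q ∖ {u, v}, enlarged by u and v, stays
-- independent on Q, and it spans every row on Q: a row is represented off {u, v} by the smaller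
-- set, and adding a suitable multiple of row u + row v, which vanishes off {u, v}, repairs the
-- columns u and v. By the Steinitz exchange lemma, deleting the two twins therefore lowers the
-- rank by exactly 2. Induction over the matching, with the rank of G − V(M) identified with that
-- of the principal submatrix on the uncovered vertices, gives the theorem.

module Submission where

open import Defs hiding (sym)

open import Algebra.Bundles using (CommutativeRing)
open import Data.Bool using (Bool; true; false; _∧_; _∨_; _xor_; not; if_then_else_)
open import Data.Bool.ListAction using (any)
open import Data.Bool.Properties as Bool
  using (∧-comm; ∧-assoc; ∧-identityʳ; ∧-zeroʳ; ∨-identityʳ; ∨-zeroʳ; xor-same; xor-identityʳ;
         xor-assoc; ∧-distribˡ-xor; xor-∧-commutativeRing)
open import Algebra.Properties.CommutativeSemigroup
  (CommutativeRing.+-commutativeSemigroup xor-∧-commutativeRing) using (interchange)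
open import Data.Empty using (⊥; ⊥-elim)
open import Data.Fin using (Fin; zero; suc; _≟_)
open import Data.Fin.Properties using (all?; any?; 0≢1+n; suc-injective)
open import Data.List using (List; []; _∷_; foldr; map; filterᵇ; length; lookup; allFin)
open import Data.List.Membership.Propositional using (_∈_; lose)
open import Data.List.Membership.Propositional.Properties
  using (∈-lookup; ∈-allFin; ∈-map⁺; ∈-map⁻; ∈-++⁺ˡ; ∈-++⁺ʳ; ∈-filter⁺; ∈-filter⁻)
open import Data.List.Properties using (foldr-preservesᵇ; foldr-preservesᵒ)
open import Data.List.Relation.Unary.All as All using (All; []; _∷_)
open import Data.List.Relation.Unary.AllPairs using (_∷_)
open import Data.List.Relation.Unary.Any as Any using (Any; here; there; satisfied)
open import Data.List.Relation.Unary.Any.Properties using (lookup-index)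
open import Data.List.Relation.Unary.Unique.Propositional using (Unique)
import Data.List.Relation.Unary.Unique.Propositional.Properties as Unique
open import Data.Nat using (ℕ; zero; suc; _+_; _*_; _≤_; _⊔_; z≤n; s≤s)
open import Data.Nat.Properties
  using (+-suc; *-suc; ≤-refl; ≤-trans; ≤-antisym; <-irrefl; m≤n+m; ⊔-sel; m≤n⇒m≤n⊔o; m≤n⇒m≤o⊔n;
         module ≤-Reasoning)
open import Data.Product using (Σ; ∃; _×_; _,_; proj₁; proj₂)
open import Data.Sum using (inj₂; [_,_]′)
open import Function using (_∘_; case_of_; _⇔_; mk⇔; Equivalence)
open import Relation.Binary.PropositionalEquality
open import Relation.Nullary using (¬_; Dec; yes; no)
open import Relation.Nullary.Decidable using (⌊_⌋; T?; _×-dec_; _→-dec_; map′)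

open Equivalence using (to; from)

private variable
  m n k ℓ : ℕ

infix 4 _==_

_==_ : Fin n → Fin n → Bool
x == y = ⌊ x ≟ y ⌋

==-refl : (x : Fin n) → (x == x) ≡ true
==-refl x with x ≟ x
... | yes _   = refl
... | no x≢x = ⊥-elim (x≢x refl)

≢⇒==-false : {x y : Fin n} → x ≢ y → (x == y) ≡ false
≢⇒==-false {x = x} {y} x≢y with x ≟ y
... | yes x≡y = ⊥-elim (x≢y x≡y)
... | no _    = refl

==⇒≡ : {x y : Fin n} → (x == y) ≡ true → x ≡ y
==⇒≡ {x = x} {y} e with x ≟ y
... | yes x≡y = x≡y

==-suc : (x y : Fin n) → (suc x == suc y) ≡ (x == y)
==-suc x y with x ≟ y
... | yes _ = refl
... | no _  = refl

==-false⇒≢ : {x y : Fin n} → (x == y) ≡ false → x ≢ y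
==-false⇒≢ {x = x} x==x≡false refl = Bool.not-¬ (==-refl x) x==x≡false

xor≡false⇒≡ : ∀ {x y} → x xor y ≡ false → x ≡ y
xor≡false⇒≡ {true}  {true}  _ = refl
xor≡false⇒≡ {false} {false} _ = refl
xor≡false⇒≡ {true}  {false} ()
xor≡false⇒≡ {false} {true}  ()

xor-cancelˡ : ∀ x y z → (x xor y) xor (x xor z) ≡ y xor z
xor-cancelˡ x y z = trans (interchange x y x z) (cong (_xor (y xor z)) (xor-same x))

xor-cancelʳ : ∀ x y → (x xor y) xor y ≡ x
xor-cancelʳ x y = trans (xor-assoc x y y) (trans (cong (x xor_) (xor-same y)) (xor-identityʳ x))

xor-restore : ∀ x y → y xor (x xor y) ≡ x
xor-restore x y =
  trans (cong (y xor_) (Bool.xor-comm x y)) (trans (sym (xor-assoc y y x)) (cong (_xor x) (xor-same y)))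

∧-xor-cancel : ∀ a f r r₀ → ((a ∧ f) xor r) xor (a ∧ (f xor r₀)) ≡ r xor (a ∧ r₀)
∧-xor-cancel a f r r₀ =
  trans (cong (((a ∧ f) xor r) xor_) (∧-distribˡ-xor a f r₀)) (xor-cancelˡ (a ∧ f) r (a ∧ r₀))

infixl 6 _⊕_ _∖_
infix 4 _⊆_
infixr 7 _·_
infixl 7 _∩_

∅ : SubsetF m
∅ _ = false

full : SubsetF m
full _ = true

⁅_⁆ : Fin m → SubsetF m
⁅ a ⁆ i = i == a

_⊕_ : SubsetF m → SubsetF m → SubsetF m
(U ⊕ V) i = U i xor V i

_∩_ : SubsetF m → SubsetF m → SubsetF m
(U ∩ V) i = U i ∧ V i

_·_ : Bool → SubsetF m → SubsetF m
(b · U) i = b ∧ U i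

_∖_ : SubsetF m → Fin m → SubsetF m
(U ∖ a) i = U i ∧ not (i == a)

_∪⁅_⁆ : SubsetF m → Fin m → SubsetF m
(U ∪⁅ a ⁆) i = U i ∨ (i == a)

_⊆_ : SubsetF m → SubsetF m → Set
U ⊆ V = ∀ i → U i ≡ true → V i ≡ true

Nonempty : SubsetF m → Set
Nonempty U = ∃ λ i → U i ≡ true

∖-⊆ : (U : SubsetF m) (a : Fin m) → U ∖ a ⊆ U
∖-⊆ U a i = Bool.∧-conicalˡ (U i) _

∖-decompose : (U : SubsetF m) (a : Fin m) → U ≗ U ∖ a ⊕ U a · ⁅ a ⁆
∖-decompose U a i with i ≟ a
... | no _ = sym (trans (cong₂ _xor_ (∧-identityʳ (U i)) (∧-zeroʳ (U a))) (xor-identityʳ (U i)))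
... | yes refl with U i
...   | true  = refl
...   | false = refl

∖-suc : (U : SubsetF (suc m)) (a : Fin m) → (U ∘ suc) ∖ a ≗ (U ∖ suc a) ∘ suc
∖-suc U a i = cong (λ x → U (suc i) ∧ not x) (sym (==-suc i a))

∪⁅⁆-∋ : (T : SubsetF m) (a : Fin m) → (T ∪⁅ a ⁆) a ≡ true
∪⁅⁆-∋ T a = trans (cong (T a ∨_) (==-refl a)) (∨-zeroʳ (T a))

∪⁅⁆-⊇ : (T : SubsetF m) (a : Fin m) → T ⊆ T ∪⁅ a ⁆
∪⁅⁆-⊇ T a i Ti = cong (_∨ (i == a)) Ti

⁅⁆-⊆ : {T : SubsetF m} {a : Fin m} → T a ≡ true → ⁅ a ⁆ ⊆ T
⁅⁆-⊆ {T = T} Ta i i==a = subst (λ x → T x ≡ true) (sym (==⇒≡ i==a)) Ta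

⊕·-⊆ : {U V P : SubsetF m} (b : Bool) → U ⊆ P → V ⊆ P → U ⊕ b · V ⊆ P
⊕·-⊆ {U = U} {V} b U⊆P V⊆P i e with U i in Ui | b | V i in Vi
... | true  | _     | _    = U⊆P i Ui
... | false | true  | true = V⊆P i Vi

∖-∉ : (U : SubsetF m) (a i : Fin m) → (U ∖ a) i ≡ true → (i == a) ≡ false
∖-∉ U a i e = Bool.not-injective (Bool.∧-conicalʳ (U i) _ e)

⊆∪⁅⁆-≢ : {U T : SubsetF m} {a : Fin m} → U ⊆ T ∪⁅ a ⁆ →
  ∀ i → U i ≡ true → (i == a) ≡ false → T i ≡ true
⊆∪⁅⁆-≢ {T = T} U⊆T+a i Ui i≠a =
  trans (sym (∨-identityʳ (T i))) (trans (cong (T i ∨_) (sym i≠a)) (U⊆T+a i Ui))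

∖-≢ : (U : SubsetF m) (a i : Fin m) → (U ∖ a) i ≡ true → i ≢ a
∖-≢ U a i = ==-false⇒≢ ∘ ∖-∉ U a i

∖-∈ : {U : SubsetF m} {a i : Fin m} → U i ≡ true → i ≢ a → (U ∖ a) i ≡ true
∖-∈ Ui i≢a = cong₂ (λ x y → x ∧ not y) Ui (≢⇒==-false i≢a)

∖-⊆-∪⁅⁆ : {U T : SubsetF m} {a : Fin m} → U ⊆ T ∪⁅ a ⁆ → U ∖ a ⊆ T
∖-⊆-∪⁅⁆ {U = U} {a = a} U⊆T+a j e = ⊆∪⁅⁆-≢ U⊆T+a j (∖-⊆ U a j e) (∖-∉ U a j e)

∖∖≗∅ : {U : SubsetF m} {a b : Fin m} → U ∖ a ∖ b ≗ ∅ → U a ≡ false → U b ≡ false → U ≗ ∅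
∖∖≗∅ {U = U} {a} {b} empty Ua Ub i with U i in Ui | i ≟ a | i ≟ b
... | false | _        | _        = refl
... | true  | yes refl | _        = trans (sym Ui) Ua
... | true  | no _     | yes refl = trans (sym Ui) Ub
... | true  | no i≢a   | no i≢b   = trans (sym (∖-∈ {U = U ∖ a} (∖-∈ {U = U} Ui i≢a) i≢b)) (empty i)

∖-⊆-∖ : {V Q : SubsetF m} {a : Fin m} → V ⊆ Q → V ∖ a ⊆ Q ∖ a
∖-⊆-∖ {V = V} {Q} {a} V⊆Q i e = ∖-∈ {U = Q} (V⊆Q i (∖-⊆ V a i e)) (∖-≢ V a i e)

∪⁅⁆-⊆ : {T Q : SubsetF m} {a : Fin m} → T ⊆ Q → Q a ≡ true → T ∪⁅ a ⁆ ⊆ Q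
∪⁅⁆-⊆ {T = T} T⊆Q Qa i e with T i in Ti
... | true  = T⊆Q i Ti
... | false = ⁅⁆-⊆ Qa i e

nonempty? : (U : SubsetF m) → Dec (Nonempty U)
nonempty? U = any? (λ i → U i Bool.≟ true)

¬Nonempty⇒≗∅ : {U : SubsetF m} → ¬ Nonempty U → U ≗ ∅
¬Nonempty⇒≗∅ ¬ne i = Bool.¬-not (λ Ui → ¬ne (i , Ui))

_⊆?_ : (U V : SubsetF m) → Dec (U ⊆ V)
U ⊆? V = all? (λ i → (U i Bool.≟ true) →-dec (V i Bool.≟ true))

allSubsets-complete : (U : SubsetF m) → ∃ λ U′ → U′ ∈ allSubsets m × U′ ≗ U
allSubsets-complete {zero}  U = (λ ()) , here refl , λ ()
allSubsets-complete {suc m} U with allSubsets-complete (U ∘ suc) | U zero in U₀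
... | V , V∈ , V≗ | false = _ , ∈-++⁺ˡ (∈-map⁺ _ V∈) , λ { zero → sym U₀ ; (suc i) → V≗ i }
... | V , V∈ , V≗ | true  = _ , ∈-++⁺ʳ _ (∈-map⁺ _ V∈) , λ { zero → sym U₀ ; (suc i) → V≗ i }

search-subsets : {P : SubsetF m → Set} → (∀ {U V} → U ≗ V → P U → P V) →
  (∀ U → Dec (P U)) → Dec (∃ P)
search-subsets {m} {P} resp P? = map′ satisfied found (Any.any? P? (allSubsets m))
  where
  found : ∃ P → Any P (allSubsets m)
  found (U , PU) = let U′ , U′∈ , U′≗U = allSubsets-complete U in lose U′∈ (resp (sym ∘ U′≗U) PU)

sum₂-cong : {f g : Fin m → Bool} → f ≗ g → sum₂ f ≡ sum₂ g
sum₂-cong {zero}  _   = refl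
sum₂-cong {suc m} f≗g = cong₂ _xor_ (f≗g zero) (sum₂-cong (f≗g ∘ suc))

sum₂-∅ : sum₂ {m} ∅ ≡ false
sum₂-∅ {zero}  = refl
sum₂-∅ {suc m} = sum₂-∅ {m}

sum₂-⊕ : (f g : Fin m → Bool) → sum₂ (f ⊕ g) ≡ sum₂ f xor sum₂ g
sum₂-⊕ {zero}  f g = refl
sum₂-⊕ {suc m} f g =
  trans (cong ((f zero xor g zero) xor_) (sum₂-⊕ (f ∘ suc) (g ∘ suc)))
        (interchange (f zero) (g zero) (sum₂ (f ∘ suc)) (sum₂ (g ∘ suc)))

sum₂-· : (b : Bool) (f : Fin m → Bool) → sum₂ (b · f) ≡ b ∧ sum₂ f
sum₂-· true  f = refl
sum₂-· {m} false f = sum₂-∅ {m}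

sum₂-⁅⁆ : (a : Fin m) (f : Fin m → Bool) → sum₂ (⁅ a ⁆ ∩ f) ≡ f a
sum₂-⁅⁆ {suc m} zero f = trans (cong (f zero xor_) (sum₂-∅ {m})) (xor-identityʳ (f zero))
sum₂-⁅⁆ (suc a) f =
  trans (sum₂-cong (λ i → cong (_∧ f (suc i)) (==-suc i a))) (sum₂-⁅⁆ a (f ∘ suc))

sum₂-∩-congˡ : {U V : SubsetF m} → U ≗ V → (f : Fin m → Bool) → sum₂ (U ∩ f) ≡ sum₂ (V ∩ f)
sum₂-∩-congˡ U≗V f = sum₂-cong (λ i → cong (_∧ f i) (U≗V i))

sum₂-∩-congʳ : (U : SubsetF m) {f g : Fin m → Bool} →
  (∀ i → U i ≡ true → f i ≡ g i) → sum₂ (U ∩ f) ≡ sum₂ (U ∩ g)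
sum₂-∩-congʳ U {f} {g} f≐g = sum₂-cong pointwise
  where
  pointwise : ∀ i → U i ∧ f i ≡ U i ∧ g i
  pointwise i with U i in Ui
  ... | true  = f≐g i Ui
  ... | false = refl

sum₂-∅∩ : {U : SubsetF m} → U ≗ ∅ → (f : Fin m → Bool) → sum₂ (U ∩ f) ≡ false
sum₂-∅∩ {m} U≗∅ f = trans (sum₂-∩-congˡ U≗∅ f) (sum₂-∅ {m})

sum₂-⊕∩ : (U V f : SubsetF m) → sum₂ ((U ⊕ V) ∩ f) ≡ sum₂ (U ∩ f) xor sum₂ (V ∩ f)
sum₂-⊕∩ U V f = trans (sum₂-cong (λ i → Bool.∧-distribʳ-xor (f i) (U i) (V i))) (sum₂-⊕ (U ∩ f) (V ∩ f))

sum₂-∩⊕ : (U f g : SubsetF m) → sum₂ (U ∩ (f ⊕ g)) ≡ sum₂ (U ∩ f) xor sum₂ (U ∩ g)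
sum₂-∩⊕ U f g = trans (sum₂-cong (λ i → ∧-distribˡ-xor (U i) (f i) (g i))) (sum₂-⊕ (U ∩ f) (U ∩ g))

sum₂-·∩ : (b : Bool) (U f : SubsetF m) → sum₂ ((b · U) ∩ f) ≡ b ∧ sum₂ (U ∩ f)
sum₂-·∩ b U f = trans (sum₂-cong (λ i → ∧-assoc b (U i) (f i))) (sum₂-· b (U ∩ f))

sum₂-∩-∧ʳ : (U f : SubsetF m) (b : Bool) → sum₂ (U ∩ (λ i → f i ∧ b)) ≡ sum₂ (U ∩ f) ∧ b
sum₂-∩-∧ʳ U f b = begin
  sum₂ (U ∩ (λ i → f i ∧ b))  ≡⟨ sum₂-cong (λ i → trans (sym (∧-assoc (U i) (f i) b)) (∧-comm _ b)) ⟩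
  sum₂ (b · (U ∩ f))          ≡⟨ sum₂-· b (U ∩ f) ⟩
  b ∧ sum₂ (U ∩ f)            ≡⟨ ∧-comm b _ ⟩
  sum₂ (U ∩ f) ∧ b            ∎
  where open ≡-Reasoning

sum₂-∩-split : (U : SubsetF m) (a : Fin m) (f : Fin m → Bool) →
  sum₂ (U ∩ f) ≡ sum₂ ((U ∖ a) ∩ f) xor (U a ∧ f a)
sum₂-∩-split U a f = begin
  sum₂ (U ∩ f)                                          ≡⟨ sum₂-∩-congˡ (∖-decompose U a) f ⟩
  sum₂ ((U ∖ a ⊕ U a · ⁅ a ⁆) ∩ f)                      ≡⟨ sum₂-⊕∩ (U ∖ a) _ f ⟩
  sum₂ ((U ∖ a) ∩ f) xor sum₂ ((U a · ⁅ a ⁆) ∩ f)       ≡⟨ cong (sum₂ ((U ∖ a) ∩ f) xor_) (sum₂-·∩ (U a) ⁅ a ⁆ f) ⟩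
  sum₂ ((U ∖ a) ∩ f) xor (U a ∧ sum₂ (⁅ a ⁆ ∩ f))       ≡⟨ cong (λ x → sum₂ ((U ∖ a) ∩ f) xor (U a ∧ x)) (sum₂-⁅⁆ a f) ⟩
  sum₂ ((U ∖ a) ∩ f) xor (U a ∧ f a)                    ∎
  where open ≡-Reasoning

sum₂≡true⇒Nonempty : {f : Fin m → Bool} → sum₂ f ≡ true → Nonempty f
sum₂≡true⇒Nonempty {m} {f} sum≡true with nonempty? f
... | yes ne  = ne
... | no ¬ne = ⊥-elim (Bool.not-¬ sum≡true (trans (sum₂-cong (¬Nonempty⇒≗∅ ¬ne)) (sum₂-∅ {m})))

card-cong : {U V : SubsetF m} → U ≗ V → card U ≡ card V
card-cong {zero}  _   = refl
card-cong {suc m} U≗V rewrite U≗V zero = cong (_ +_) (card-cong (U≗V ∘ suc))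

card-∅ : {U : SubsetF m} → U ≗ ∅ → card U ≡ 0
card-∅ {zero}  _   = refl
card-∅ {suc m} U≗∅ rewrite U≗∅ zero = card-∅ (U≗∅ ∘ suc)

card-split : (U : SubsetF m) (a : Fin m) → card U ≡ (if U a then 1 else 0) + card (U ∖ a)
card-split {suc m} U zero with U zero
... | true  = cong suc (card-cong (λ i → sym (∧-identityʳ (U (suc i)))))
... | false = card-cong (λ i → sym (∧-identityʳ (U (suc i))))
card-split {suc m} U (suc a) with U zero
... | true  = begin
  suc (card (U ∘ suc))                          ≡⟨ cong suc (card-split (U ∘ suc) a) ⟩
  suc (c + card ((U ∘ suc) ∖ a))                ≡⟨ cong (λ x → suc (c + x)) (card-cong (∖-suc U a)) ⟩
  suc (c + card ((U ∖ suc a) ∘ suc))            ≡⟨ sym (+-suc c _) ⟩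
  c + suc (card ((U ∖ suc a) ∘ suc))            ∎
  where
  open ≡-Reasoning
  c = if U (suc a) then 1 else 0
... | false = trans (card-split (U ∘ suc) a) (cong ((if U (suc a) then 1 else 0) +_) (card-cong (∖-suc U a)))

card-∖ : (U : SubsetF m) (a : Fin m) → U a ≡ true → card U ≡ suc (card (U ∖ a))
card-∖ U a Ua = trans (card-split U a) (cong (λ x → (if x then 1 else 0) + card (U ∖ a)) Ua)

card-∪⁅⁆ : (T : SubsetF m) (a : Fin m) → T a ≡ false → card (T ∪⁅ a ⁆) ≡ suc (card T)
card-∪⁅⁆ T a Ta = begin
  card (T ∪⁅ a ⁆)                                                   ≡⟨ card-split (T ∪⁅ a ⁆) a ⟩
  (if T a ∨ (a == a) then 1 else 0) + card (T ∪⁅ a ⁆ ∖ a)           ≡⟨ cong₂ (λ x y → (if x then 1 else 0) + y)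
                                                                           (∪⁅⁆-∋ T a) (card-cong restore) ⟩
  suc (card T)                                                       ∎
  where
  open ≡-Reasoning
  restore : T ∪⁅ a ⁆ ∖ a ≗ T
  restore i with i ≟ a
  ... | yes refl = trans (∧-zeroʳ _) (sym Ta)
  ... | no _     = trans (∧-identityʳ _) (∨-identityʳ (T i))

VanishesOn : SubsetF k → (Fin k → Bool) → Set
VanishesOn Q v = ∀ c → Q c ≡ true → v c ≡ false

_≈[_]_ : (Fin k → Bool) → SubsetF k → (Fin k → Bool) → Set
v ≈[ Q ] w = ∀ c → Q c ≡ true → v c ≡ w c

_≈?[_]_ : (v : Fin k → Bool) (Q : SubsetF k) (w : Fin k → Bool) → Dec (v ≈[ Q ] w)
v ≈?[ Q ] w = all? (λ c → (Q c Bool.≟ true) →-dec (v c Bool.≟ w c))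

IndependentOn : Matrix m k → SubsetF k → SubsetF m → Set
IndependentOn A Q T = ∀ U → U ⊆ T → Nonempty U → ¬ VanishesOn Q (rowSum A U)

InSpanOn : SubsetF k → Matrix m k → SubsetF m → (Fin k → Bool) → Set
InSpanOn Q F P v = ∃ λ W → W ⊆ P × v ≈[ Q ] rowSum F W

rowSum-⁅⁆ : (A : Matrix m k) (a : Fin m) → rowSum A ⁅ a ⁆ ≗ A a
rowSum-⁅⁆ A a c = sum₂-⁅⁆ a (λ i → A i c)

rowSum-congˡ : (A : Matrix m k) {U V : SubsetF m} → U ≗ V → rowSum A U ≗ rowSum A V
rowSum-congˡ A U≗V c = sum₂-∩-congˡ U≗V (λ i → A i c)

InSpanOn-row : (Q : SubsetF k) (A : Matrix m k) {T : SubsetF m} {s : Fin m} →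
  T s ≡ true → InSpanOn Q A T (A s)
InSpanOn-row Q A {s = s} Ts = ⁅ s ⁆ , ⁅⁆-⊆ Ts , λ c _ → sym (rowSum-⁅⁆ A s c)

IndependentOn-cong : {A : Matrix m k} {Q : SubsetF k} {T T′ : SubsetF m} → T ≗ T′ →
  IndependentOn A Q T → IndependentOn A Q T′
IndependentOn-cong T≗T′ indep U U⊆T′ = indep U (λ i Ui → trans (T≗T′ i) (U⊆T′ i Ui))

IndependentOn-eliminate : {G : Matrix m k} {Q : SubsetF k} {S : SubsetF m} {s₀ : Fin m} (a : Fin m → Bool) →
  S s₀ ≡ true → IndependentOn G Q S → IndependentOn (λ s → G s ⊕ a s · G s₀) Q (S ∖ s₀)
IndependentOn-eliminate {G = G} {Q} {S} {s₀} a Ss₀ indep U U⊆S′ (i , Ui) vanish =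
  indep U′ U′⊆S (i , U′i) (λ c Qc → trans (sym (same-sum c)) (vanish c Qc))
  where
  b = sum₂ (U ∩ a)
  U′ = U ⊕ b · ⁅ s₀ ⁆
  U′⊆S : U′ ⊆ S
  U′⊆S = ⊕·-⊆ b (λ j Uj → ∖-⊆ S s₀ j (U⊆S′ j Uj)) (⁅⁆-⊆ Ss₀)
  U′i : U′ i ≡ true
  U′i rewrite ∖-∉ S s₀ i (U⊆S′ i Ui) | Ui | ∧-zeroʳ b = refl
  same-sum : ∀ c → rowSum (λ s → G s ⊕ a s · G s₀) U c ≡ rowSum G U′ c
  same-sum c = begin
    sum₂ (U ∩ (λ s → G s c xor (a s ∧ G s₀ c)))           ≡⟨ sum₂-∩⊕ U (λ s → G s c) _ ⟩
    rowSum G U c xor sum₂ (U ∩ (λ s → a s ∧ G s₀ c))      ≡⟨ cong (rowSum G U c xor_) (sum₂-∩-∧ʳ U a (G s₀ c)) ⟩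
    rowSum G U c xor (b ∧ G s₀ c)                          ≡⟨ cong (λ x → rowSum G U c xor (b ∧ x)) (sym (rowSum-⁅⁆ G s₀ c)) ⟩
    rowSum G U c xor (b ∧ rowSum G ⁅ s₀ ⁆ c)               ≡⟨ cong (rowSum G U c xor_) (sym (sum₂-·∩ b ⁅ s₀ ⁆ (λ s → G s c))) ⟩
    rowSum G U c xor rowSum G (b · ⁅ s₀ ⁆) c               ≡⟨ sym (sum₂-⊕∩ U (b · ⁅ s₀ ⁆) (λ s → G s c)) ⟩
    rowSum G U′ c                                          ∎
    where open ≡-Reasoning

-- Steinitz exchange by induction on the rows of F: a row of G whose representation W uses the
-- first row of F is pivoted on, and that row is eliminated from the representations of the others.
steinitz-along : (Q : SubsetF k) (F : Matrix m k) (P : SubsetF m) {m′ : ℕ} (G : Matrix m′ k) (S : SubsetF m′)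
  (W : Fin m′ → SubsetF m) → (∀ s → S s ≡ true → W s ⊆ P × G s ≈[ Q ] rowSum F (W s)) →
  IndependentOn G Q S → card S ≤ card P
steinitz-along {m = zero} Q F P G S W spans indep with nonempty? S
... | no ¬ne = subst (_≤ card P) (sym (card-∅ (¬Nonempty⇒≗∅ ¬ne))) z≤n
... | yes (s , Ss) = ⊥-elim (indep ⁅ s ⁆ (⁅⁆-⊆ Ss) (s , ==-refl s)
                       (λ c Qc → trans (rowSum-⁅⁆ G s c) (proj₂ (spans s Ss) c Qc)))
steinitz-along {m = suc m} Q F P G S W spans indep with nonempty? (S ∩ λ s → W s zero)
... | no ¬ne = ≤-trans (steinitz-along Q (F ∘ suc) (P ∘ suc) G S (λ s → W s ∘ suc) spans′ indep) (m≤n+m _ _)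
  where
  spans′ : ∀ s → S s ≡ true → W s ∘ suc ⊆ P ∘ suc × G s ≈[ Q ] rowSum (F ∘ suc) (W s ∘ suc)
  spans′ s Ss = (λ i → proj₁ (spans s Ss) (suc i)) , λ c Qc →
    trans (proj₂ (spans s Ss) c Qc) (cong (λ x → (x ∧ F zero c) xor rowSum (F ∘ suc) (W s ∘ suc) c) Ws₀)
    where
    Ws₀ : W s zero ≡ false
    Ws₀ = trans (cong (_∧ W s zero) (sym Ss)) (¬Nonempty⇒≗∅ ¬ne s)
... | yes (s₀ , S∩Ws₀) = let open ≤-Reasoning in begin
  card S                       ≡⟨ card-∖ S s₀ Ss₀ ⟩
  suc (card (S ∖ s₀))          ≤⟨ s≤s (steinitz-along Q (F ∘ suc) (P ∘ suc) G′ (S ∖ s₀) W′ spans′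
                                         (IndependentOn-eliminate a Ss₀ indep)) ⟩
  suc (card (P ∘ suc))         ≡⟨ cong (λ x → (if x then 1 else 0) + card (P ∘ suc)) (sym P₀) ⟩
  card P                       ∎
  where
  a : Fin _ → Bool
  a s = W s zero
  Ss₀ = Bool.∧-conicalˡ _ _ S∩Ws₀
  as₀ = Bool.∧-conicalʳ _ _ S∩Ws₀
  P₀ : P zero ≡ true
  P₀ = proj₁ (spans s₀ Ss₀) zero as₀
  G′ = λ s → G s ⊕ a s · G s₀
  W′ = λ s → (W s ⊕ a s · W s₀) ∘ suc
  spans′ : ∀ s → (S ∖ s₀) s ≡ true → W′ s ⊆ P ∘ suc × G′ s ≈[ Q ] rowSum (F ∘ suc) (W′ s)
  spans′ s Ss′ = (λ i → ⊕·-⊆ (a s) (proj₁ (spans s Ss)) (proj₁ (spans s₀ Ss₀)) (suc i)) , G′≈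
    where
    Ss = ∖-⊆ S s₀ s Ss′
    R = λ s → rowSum (F ∘ suc) (W s ∘ suc)
    G′≈ : G′ s ≈[ Q ] rowSum (F ∘ suc) (W′ s)
    G′≈ c Qc = begin
      G s c xor (a s ∧ G s₀ c)                ≡⟨ cong₂ (λ x y → x xor (a s ∧ y)) (proj₂ (spans s Ss) c Qc) G₀ ⟩
      (a s ∧ F zero c xor R s c) xor (a s ∧ (F zero c xor R s₀ c))
                                              ≡⟨ ∧-xor-cancel (a s) (F zero c) (R s c) (R s₀ c) ⟩
      R s c xor (a s ∧ R s₀ c)                ≡⟨ cong (R s c xor_) (sym (sum₂-·∩ (a s) (W s₀ ∘ suc) _)) ⟩
      R s c xor sum₂ ((a s · W s₀ ∘ suc) ∩ _) ≡⟨ sym (sum₂-⊕∩ (W s ∘ suc) (a s · W s₀ ∘ suc) _) ⟩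
      rowSum (F ∘ suc) (W′ s) c               ∎
      where
      open ≡-Reasoning
      G₀ : G s₀ c ≡ F zero c xor R s₀ c
      G₀ = trans (proj₂ (spans s₀ Ss₀) c Qc) (cong (λ x → (x ∧ F zero c) xor R s₀ c) as₀)

choice : {A : Set} {P : Fin n → A → Set} (S : SubsetF n) → A →
  (∀ s → S s ≡ true → ∃ (P s)) → ∃ λ (f : Fin n → A) → ∀ s → S s ≡ true → P s (f s)
choice {A = A} {P} S default h = (λ s → pick s (S s) refl) , λ s Ss → pick-sound s (S s) refl Ss
  where
  pick : ∀ s b → S s ≡ b → A
  pick s true  Ss = proj₁ (h s Ss)
  pick s false _  = default
  pick-sound : ∀ s b (e : S s ≡ b) → b ≡ true → P s (pick s b e)
  pick-sound s true e _ = proj₂ (h s e)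

steinitz : (Q : SubsetF k) (F : Matrix m k) (P : SubsetF m) {m′ : ℕ} (G : Matrix m′ k) (S : SubsetF m′) →
  (∀ s → S s ≡ true → InSpanOn Q F P (G s)) → IndependentOn G Q S → card S ≤ card P
steinitz Q F P G S spans = steinitz-along Q F P G S W W-spans
  where
  open Σ (choice S ∅ spans) renaming (proj₁ to W; proj₂ to W-spans)

inSpanOn? : (Q : SubsetF k) (F : Matrix m k) (P : SubsetF m) (v : Fin k → Bool) → Dec (InSpanOn Q F P v)
inSpanOn? Q F P v = search-subsets respects (λ W → (W ⊆? P) ×-dec (v ≈?[ Q ] rowSum F W))
  where
  respects : ∀ {U V} → U ≗ V → U ⊆ P × v ≈[ Q ] rowSum F U → V ⊆ P × v ≈[ Q ] rowSum F V
  respects U≗V (U⊆P , v≈) = (λ i Vi → U⊆P i (trans (U≗V i) Vi)) ,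
                        λ c Qc → trans (v≈ c Qc) (rowSum-congˡ F U≗V c)

IndependentOn-∪⁅⁆ : {A : Matrix m k} {Q : SubsetF k} {T : SubsetF m} {s : Fin m} →
  IndependentOn A Q T → ¬ InSpanOn Q A T (A s) → IndependentOn A Q (T ∪⁅ s ⁆)
IndependentOn-∪⁅⁆ {A = A} {Q} {T} {s} indep ¬span U U⊆T+s (i , Ui) vanish with U s in Us
... | true  =
  ¬span (U ∖ s , ∖-⊆-∪⁅⁆ U⊆T+s , λ c Qc → sym (xor≡false⇒≡ (trans (sym (split c)) (vanish c Qc))))
  where
  split : ∀ c → rowSum A U c ≡ rowSum A (U ∖ s) c xor A s c
  split c = trans (sum₂-∩-split U s (λ j → A j c)) (cong (λ x → rowSum A (U ∖ s) c xor (x ∧ A s c)) Us)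
... | false = indep U U⊆T (i , Ui) vanish
  where
  U⊆T : U ⊆ T
  U⊆T j Uj with j ≟ s
  ... | yes refl = ⊥-elim (Bool.not-¬ Uj Us)
  ... | no j≢s   = ⊆∪⁅⁆-≢ U⊆T+s j Uj (≢⇒==-false j≢s)

Independent : Matrix n n → SubsetF n → SubsetF n → Set
Independent A Q T = T ⊆ Q × IndependentOn A Q T

-- The principal submatrix of A on the index set Q has rank d over 𝔽₂.
HasRank : Matrix n n → SubsetF n → ℕ → Set
HasRank A Q d = (∃ λ T → Independent A Q T × card T ≡ d) × (∀ T → Independent A Q T → card T ≤ d)

HasRank-unique : {A : Matrix n n} {Q : SubsetF n} {d d′ : ℕ} → HasRank A Q d → HasRank A Q d′ → d ≡ d′
HasRank-unique ((T , indep , refl) , maximal) ((T′ , indep′ , refl) , maximal′) =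
  ≤-antisym (maximal′ T indep) (maximal T′ indep′)

Independent-cong : {A : Matrix n n} {Q Q′ T : SubsetF n} → Q ≗ Q′ → Independent A Q T → Independent A Q′ T
Independent-cong Q≗Q′ (T⊆Q , indep) =
  (λ i Ti → trans (sym (Q≗Q′ i)) (T⊆Q i Ti)) ,
  λ U U⊆T ne vanish → indep U U⊆T ne (λ c Qc → vanish c (trans (sym (Q≗Q′ c)) Qc))

HasRank-cong : {A : Matrix n n} {Q Q′ : SubsetF n} {d : ℕ} → Q ≗ Q′ → HasRank A Q d → HasRank A Q′ d
HasRank-cong Q≗Q′ ((T , indep , cardT) , maximal) =
  (T , Independent-cong Q≗Q′ indep , cardT) , λ T′ → maximal T′ ∘ Independent-cong (sym ∘ Q≗Q′)

maximum-spans : {A : Matrix n n} {Q T : SubsetF n} → Independent A Q T →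
  (∀ T′ → Independent A Q T′ → card T′ ≤ card T) → ∀ {s} → Q s ≡ true → InSpanOn Q A T (A s)
maximum-spans {A = A} {Q} {T} (T⊆Q , indep) maximal {s} Qs with T s in Ts | inSpanOn? Q A T (A s)
... | true  | _        = InSpanOn-row Q A Ts
... | false | yes span = span
... | false | no ¬span = ⊥-elim (<-irrefl refl (subst (_≤ card T) (card-∪⁅⁆ T s Ts) (maximal _ T+s)))
  where
  T+s : Independent A Q (T ∪⁅ s ⁆)
  T+s = ∪⁅⁆-⊆ T⊆Q Qs , IndependentOn-∪⁅⁆ indep ¬span

allF≡true : {f : Fin m → Bool} {P : Fin m → Set} → (∀ i → f i ≡ true ⇔ P i) → allF f ≡ true ⇔ (∀ i → P i)
allF≡true {zero}  f⇔P = mk⇔ (λ _ ()) (λ _ → refl)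
allF≡true {suc m} f⇔P = mk⇔
  (λ all → λ { zero → to (f⇔P zero) (Bool.∧-conicalˡ _ _ all)
             ; (suc i) → to (allF≡true (f⇔P ∘ suc)) (Bool.∧-conicalʳ _ _ all) i })
  (λ P∀ → cong₂ _∧_ (from (f⇔P zero) (P∀ zero)) (from (allF≡true (f⇔P ∘ suc)) (P∀ ∘ suc)))

anyF≡true : (f : Fin m → Bool) → anyF f ≡ true ⇔ Nonempty f
anyF≡true {suc m} f with f zero in f₀
... | true  = mk⇔ (λ _ → zero , f₀) (λ _ → refl)
... | false = mk⇔ (λ some → let i , fi = to (anyF≡true (f ∘ suc)) some in suc i , fi) from′
  where
  from′ : Nonempty f → anyF (f ∘ suc) ≡ true
  from′ (zero  , f₀≡true) = ⊥-elim (Bool.not-¬ f₀≡true f₀)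
  from′ (suc i , fi)       = from (anyF≡true (f ∘ suc)) (i , fi)
anyF≡true {zero} f = mk⇔ (λ ()) (λ ())

⊆ᵇ≡true : (U T : SubsetF m) → (U ⊆ᵇ T) ≡ true ⇔ U ⊆ T
⊆ᵇ≡true U T = allF≡true (λ i → implication (U i) (T i))
  where
  implication : ∀ x y → (not x ∨ y) ≡ true ⇔ (x ≡ true → y ≡ true)
  implication true  y = mk⇔ (λ y≡true _ → y≡true) (λ h → h refl)
  implication false y = mk⇔ (λ _ ()) (λ _ → refl)

isZeroVec≡true : (v : Fin k → Bool) → isZeroVec v ≡ true ⇔ VanishesOn full v
isZeroVec≡true v = allF≡true (λ c → mk⇔ (λ nv≡true _ → Bool.not-injective nv≡true) (λ h → cong not (h refl)))

nand₃≡true : ∀ {x y z} → (not (x ∧ y) ∨ not z) ≡ true ⇔ (¬ (x ≡ true × y ≡ true × z ≡ true))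
nand₃≡true {true}  {true}  {true}  = mk⇔ (λ ()) (λ h → ⊥-elim (h (refl , refl , refl)))
nand₃≡true {true}  {true}  {false} = mk⇔ (λ { _ (_ , _ , ()) }) (λ _ → refl)
nand₃≡true {true}  {false}         = mk⇔ (λ { _ (_ , () , _) }) (λ _ → refl)
nand₃≡true {false}                 = mk⇔ (λ { _ (() , _) }) (λ _ → refl)

foldr-∧≡true : {A : Set} (g : A → Bool) (xs : List A) →
  foldr (λ x b → g x ∧ b) true xs ≡ true ⇔ All (λ x → g x ≡ true) xs
foldr-∧≡true g []       = mk⇔ (λ _ → []) (λ _ → refl)
foldr-∧≡true g (x ∷ xs) = mk⇔
  (λ all → Bool.∧-conicalˡ _ _ all ∷ to (foldr-∧≡true g xs) (Bool.∧-conicalʳ _ _ all))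
  (λ { (gx ∷ gxs) → cong₂ _∧_ gx (from (foldr-∧≡true g xs) gxs) })

independentRows≡true : (A : Matrix m k) (T : SubsetF m) → independentRows A T ≡ true ⇔ IndependentOn A full T
independentRows≡true {m} A T = mk⇔ to′ from′
  where
  to′ : independentRows A T ≡ true → IndependentOn A full T
  to′ rows U U⊆T (i , Ui) vanish =
    to nand₃≡true (All.lookup (to (foldr-∧≡true _ (allSubsets m)) rows) U′∈)
      ( from (⊆ᵇ≡true U′ T) (λ j U′j → U⊆T j (trans (sym (U′≗U j)) U′j))
      , from (anyF≡true U′) (i , trans (U′≗U i) Ui)
      , from (isZeroVec≡true _) (λ c _ → trans (rowSum-congˡ A U′≗U c) (vanish c refl)))
    where
    open Σ (allSubsets-complete U) renaming (proj₁ to U′; proj₂ to U′∈×U′≗U)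
    U′∈ = proj₁ U′∈×U′≗U
    U′≗U = proj₂ U′∈×U′≗U
  from′ : IndependentOn A full T → independentRows A T ≡ true
  from′ indep = from (foldr-∧≡true _ (allSubsets m)) (All.tabulate λ {U} _ →
    from nand₃≡true λ (U⊆T , ne , isZero) →
      indep U (to (⊆ᵇ≡true U T) U⊆T) (to (anyF≡true U) ne) (to (isZeroVec≡true _) isZero))

foldr-⊔-upper : (xs : List ℕ) {x : ℕ} → x ∈ xs → x ≤ foldr _⊔_ 0 xs
foldr-⊔-upper xs x∈xs =
  foldr-preservesᵒ (λ a b → [ m≤n⇒m≤n⊔o b , m≤n⇒m≤o⊔n a ]′) 0 xs (inj₂ (lose x∈xs ≤-refl))

foldr-⊔-∈ : (xs : List ℕ) → foldr _⊔_ 0 xs ∈ 0 ∷ xs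
foldr-⊔-∈ xs = foldr-preservesᵇ select (here refl) (All.tabulate there)
  where
  select : ∀ {a b} → a ∈ 0 ∷ xs → b ∈ 0 ∷ xs → a ⊔ b ∈ 0 ∷ xs
  select {a} {b} a∈ b∈ =
    [ (λ e → subst (_∈ 0 ∷ xs) (sym e) a∈) , (λ e → subst (_∈ 0 ∷ xs) (sym e) b∈) ]′ (⊔-sel a b)

rank₂-HasRank : (A : Matrix n n) → HasRank A full (rank₂ A)
rank₂-HasRank {n} A = witness (foldr-⊔-∈ (map card L)) , bound
  where
  L = filterᵇ (independentRows A) (allSubsets n)
  witness : rank₂ A ∈ 0 ∷ map card L → ∃ λ T → Independent A full T × card T ≡ rank₂ A
  witness (here r≡0) = ∅ , ((λ _ _ → refl) , λ U U⊆∅ (i , Ui) _ → Bool.not-¬ (U⊆∅ i Ui) refl) ,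
                       trans (card-∅ {n} λ _ → refl) (sym r≡0)
  witness (there r∈) with ∈-map⁻ card r∈
  ... | T , T∈L , r≡cardT = T , ((λ _ _ → refl) , to (independentRows≡true A T) rowsT) , sym r≡cardT
    where
    rowsT = to Bool.T-≡ (proj₂ (∈-filter⁻ (T? ∘ independentRows A) {xs = allSubsets n} T∈L))
  bound : ∀ T → Independent A full T → card T ≤ rank₂ A
  bound T (_ , indep) = subst (_≤ rank₂ A) (card-cong T′≗T) (foldr-⊔-upper (map card L) (∈-map⁺ card T′∈L))
    where
    open Σ (allSubsets-complete T) renaming (proj₁ to T′; proj₂ to T′∈×T′≗T)
    T′≗T = proj₂ T′∈×T′≗T
    T′∈L : T′ ∈ L
    T′∈L = ∈-filter⁺ (T? ∘ independentRows A) (proj₁ T′∈×T′≗T)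
             (from Bool.T-≡ (from (independentRows≡true A T′) (IndependentOn-cong (sym ∘ T′≗T) indep)))

record Enumeration (Q : SubsetF n) (ℓ : ℕ) : Set where
  field
    at        : Fin ℓ → Fin n
    injective : ∀ {i j} → at i ≡ at j → i ≡ j
    sound     : ∀ i → Q (at i) ≡ true
    complete  : ∀ {x} → Q x ≡ true → ∃ λ i → at i ≡ x

open Enumeration

at-suc≢at-zero : {Q : SubsetF n} (E : Enumeration Q (suc ℓ)) (i : Fin ℓ) → at E (suc i) ≢ at E zero
at-suc≢at-zero E i e = 0≢1+n (sym (injective E e))

Enumeration-tail : {Q : SubsetF n} (E : Enumeration Q (suc ℓ)) → Enumeration (Q ∖ at E zero) ℓ
Enumeration-tail {Q = Q} E = record
  { at        = at E ∘ suc
  ; injective = suc-injective ∘ injective E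
  ; sound     = λ i → ∖-∈ {U = Q} (sound E (suc i)) (at-suc≢at-zero E i)
  ; complete  = λ Q′x → tail-complete Q′x (complete E (∖-⊆ Q _ _ Q′x))
  }
  where
  tail-complete : ∀ {x} → (Q ∖ at E zero) x ≡ true → ∃ (λ i → at E i ≡ x) → ∃ λ j → at E (suc j) ≡ x
  tail-complete {x} Q′x (zero  , e) = ⊥-elim (∖-≢ Q (at E zero) x Q′x (sym e))
  tail-complete     _   (suc j , e) = j , e

∖-at-zero : {Q : SubsetF n} (E : Enumeration Q (suc ℓ)) (V : SubsetF n) (j : Fin ℓ) →
  (V ∖ at E zero) (at E (suc j)) ≡ V (at E (suc j))
∖-at-zero E V j =
  trans (cong (λ b → V (at E (suc j)) ∧ not b) (≢⇒==-false (at-suc≢at-zero E j))) (∧-identityʳ _)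

⊆-Enumeration₀ : {Q : SubsetF n} → Enumeration Q zero → {V : SubsetF n} → V ⊆ Q → V ≗ ∅
⊆-Enumeration₀ E V⊆Q x = Bool.¬-not (λ Vx → case complete E (V⊆Q x Vx) of λ ())

sum₂-enumeration : {Q : SubsetF n} (E : Enumeration Q ℓ) {V : SubsetF n} → V ⊆ Q →
  (f : Fin n → Bool) → sum₂ (V ∩ f) ≡ sum₂ ((V ∘ at E) ∩ (f ∘ at E))
sum₂-enumeration {n} {zero} E V⊆Q f = sum₂-∅∩ (⊆-Enumeration₀ E V⊆Q) f
sum₂-enumeration {n} {suc ℓ} E {V} V⊆Q f = begin
  sum₂ (V ∩ f)
    ≡⟨ sum₂-∩-split V a₀ f ⟩
  sum₂ ((V ∖ a₀) ∩ f) xor (V a₀ ∧ f a₀)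
    ≡⟨ cong (_xor (V a₀ ∧ f a₀)) (sum₂-enumeration (Enumeration-tail E) (∖-⊆-∖ V⊆Q) f) ⟩
  sum₂ (((V ∖ a₀) ∘ at E ∘ suc) ∩ (f ∘ at E ∘ suc)) xor (V a₀ ∧ f a₀)
    ≡⟨ cong (_xor (V a₀ ∧ f a₀)) (sum₂-∩-congˡ (∖-at-zero E V) (f ∘ at E ∘ suc)) ⟩
  sum₂ ((V ∘ at E ∘ suc) ∩ (f ∘ at E ∘ suc)) xor (V a₀ ∧ f a₀)
    ≡⟨ Bool.xor-comm _ (V a₀ ∧ f a₀) ⟩
  sum₂ ((V ∘ at E) ∩ (f ∘ at E))
    ∎
  where
  open ≡-Reasoning
  a₀ = at E zero

card-enumeration : {Q : SubsetF n} (E : Enumeration Q ℓ) {V : SubsetF n} → V ⊆ Q → card V ≡ card (V ∘ at E)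
card-enumeration {n} {zero} E V⊆Q = card-∅ (⊆-Enumeration₀ E V⊆Q)
card-enumeration {n} {suc ℓ} E {V} V⊆Q = begin
  card V                                                  ≡⟨ card-split V a₀ ⟩
  v₀ + card (V ∖ a₀)                                      ≡⟨ cong (v₀ +_) (card-enumeration (Enumeration-tail E) (∖-⊆-∖ V⊆Q)) ⟩
  v₀ + card ((V ∖ a₀) ∘ at E ∘ suc)                       ≡⟨ cong (v₀ +_) (card-cong (∖-at-zero E V)) ⟩
  card (V ∘ at E)                                         ∎
  where
  open ≡-Reasoning
  a₀ = at E zero
  v₀ = if V a₀ then 1 else 0

module _ {Q : SubsetF n} (E : Enumeration Q ℓ) where

  -- Since `at E` is injective, at most one summand is true.
  image : SubsetF ℓ → SubsetF n
  image U x = sum₂ (λ i → U i ∧ (at E i == x))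

  image-at : (U : SubsetF ℓ) (j : Fin ℓ) → image U (at E j) ≡ U j
  image-at U j = trans (sum₂-cong (λ i → trans (cong (U i ∧_) (at-== i)) (∧-comm (U i) _))) (sum₂-⁅⁆ j U)
    where
    at-== : ∀ i → (at E i == at E j) ≡ (i == j)
    at-== i with i ≟ j
    ... | yes refl = ==-refl (at E i)
    ... | no i≢j  = ≢⇒==-false (i≢j ∘ injective E)

  image-∈ : {U : SubsetF ℓ} {x : Fin n} → image U x ≡ true → ∃ λ i → U i ≡ true × at E i ≡ x
  image-∈ {U} img with sum₂≡true⇒Nonempty img
  ... | i , Ui∧ = i , Bool.∧-conicalˡ _ _ Ui∧ , ==⇒≡ (Bool.∧-conicalʳ (U i) _ Ui∧)

  image-⊆ : (U : SubsetF ℓ) → image U ⊆ Q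
  image-⊆ U x img with image-∈ img
  ... | i , _ , refl = sound E i

  rowSum-enumeration : (A : Matrix n n) {V : SubsetF n} → V ⊆ Q → ∀ j →
    rowSum A V (at E j) ≡ rowSum (λ i j → A (at E i) (at E j)) (V ∘ at E) j
  rowSum-enumeration A V⊆Q j = sum₂-enumeration E V⊆Q (λ i → A i (at E j))

  HasRank-enumeration : {A : Matrix n n} {d : ℕ} → HasRank (λ i j → A (at E i) (at E j)) full d → HasRank A Q d
  HasRank-enumeration {A} {d} ((T , (_ , indep) , card-T) , maximal) =
    (image T , (image-⊆ T , push indep) , trans card-image card-T) ,
    λ T′ (T′⊆Q , indep′) →
      subst (_≤ d) (sym (card-enumeration E T′⊆Q)) (maximal (T′ ∘ at E) ((λ _ _ → refl) , pull indep′))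
    where
    B = λ i j → A (at E i) (at E j)
    card-image : card (image T) ≡ card T
    card-image = trans (card-enumeration E (image-⊆ T)) (card-cong (image-at T))
    push : IndependentOn B full T → IndependentOn A Q (image T)
    push indepB U U⊆T (x , Ux) vanish with complete E (image-⊆ T x (U⊆T x Ux))
    ... | i , refl = indepB (U ∘ at E) (λ j e → trans (sym (image-at T j)) (U⊆T (at E j) e)) (i , Ux)
                       λ j _ → trans (sym (rowSum-enumeration A U⊆Q j)) (vanish (at E j) (sound E j))
      where
      U⊆Q : U ⊆ Q
      U⊆Q y e = image-⊆ T y (U⊆T y e)
    pull : {T′ : SubsetF n} → IndependentOn A Q T′ → IndependentOn B full (T′ ∘ at E)
    pull {T′} indepA U U⊆T′ (i , Ui) vanish = indepA (image U) img⊆T′ (at E i , trans (image-at U i) Ui) vanish′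
      where
      img⊆T′ : image U ⊆ T′
      img⊆T′ x img with image-∈ img
      ... | j , Uj , refl = U⊆T′ j Uj
      vanish′ : VanishesOn Q (rowSum A (image U))
      vanish′ c Qc with complete E Qc
      ... | j , refl = trans (rowSum-enumeration A (image-⊆ U) j)
                             (trans (rowSum-congˡ B (image-at U) j) (vanish j refl))

avoiding : List (Fin n) → SubsetF n
avoiding X x = not (any (x ==_) X)

avoiding-∷ : (a : Fin n) (X : List (Fin n)) → avoiding (a ∷ X) ≗ avoiding X ∖ a
avoiding-∷ a X x with x == a
... | true  = sym (∧-zeroʳ _)
... | false = sym (∧-identityʳ _)

avoiding-∉ : {x : Fin n} (X : List (Fin n)) → All (x ≢_) X → avoiding X x ≡ true
avoiding-∉ []      []           = refl
avoiding-∉ (y ∷ X) (x≢y ∷ x∉X) = trans (avoiding-∷ y X _) (∖-∈ {U = avoiding X} (avoiding-∉ X x∉X) x≢y)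

lookup-injective : {A : Set} {xs : List A} → Unique xs → ∀ {i j} → lookup xs i ≡ lookup xs j → i ≡ j
lookup-injective {xs = _ ∷ _} (_      ∷ _)      {zero}  {zero}  _ = refl
lookup-injective {xs = _ ∷ _} (x∉xs   ∷ _)      {zero}  {suc j} e = ⊥-elim (All.lookup x∉xs (∈-lookup j) e)
lookup-injective {xs = _ ∷ _} (x∉xs   ∷ _)      {suc i} {zero}  e = ⊥-elim (All.lookup x∉xs (∈-lookup i) (sym e))
lookup-injective {xs = _ ∷ _} (_      ∷ unique) {suc i} {suc j} e = cong suc (lookup-injective unique e)

remaining-Enumeration : (X : List (Fin n)) → Enumeration (avoiding X) (length (remaining X))
remaining-Enumeration {n} X = record
  { at        = lookup (remaining X)
  ; injective = lookup-injective (Unique.filter⁺ (T? ∘ avoiding X) (Unique.allFin⁺ n))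
  ; sound     = λ i → to Bool.T-≡ (proj₂ (∈-filter⁻ (T? ∘ avoiding X) {xs = allFin n} (∈-lookup i)))
  ; complete  = λ {x} Qx → let x∈ = ∈-filter⁺ (T? ∘ avoiding X) (∈-allFin x) (from Bool.T-≡ Qx)
                            in Any.index x∈ , sym (lookup-index x∈)
  }

module TwinPair (G : Graph n) {u v : Fin n} (u≢v : u ≢ v) (twins : AdjacentTwins G u v) where

  private
    A = adj G

  twin-rows : ∀ {c} → c ≢ u → c ≢ v → A u c ≡ A v c
  twin-rows {c} c≢u c≢v =
    trans (cong (_∨ A u c) (sym (≢⇒==-false (c≢u ∘ sym))))
          (trans (twins c) (cong (_∨ A v c) (≢⇒==-false (c≢v ∘ sym))))

  twin-columns : ∀ {x} → x ≢ u → x ≢ v → A x u ≡ A x v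
  twin-columns {x} x≢u x≢v = trans (Graph.sym G x u) (trans (twin-rows x≢u x≢v) (Graph.sym G v x))

  -- u ∈ N[u] = N[v]
  A-vu : A v u ≡ true
  A-vu = trans (cong (_∨ A v u) (sym (≢⇒==-false (u≢v ∘ sym))))
               (trans (sym (twins u)) (cong (_∨ A u u) (==-refl u)))

  A-uu : A u u ≡ false
  A-uu = Graph.irrefl G u

  A-vv : A v v ≡ false
  A-vv = Graph.irrefl G v

  A-uv : A u v ≡ true
  A-uv = trans (Graph.sym G u v) A-vu

  off-pair : {Q : SubsetF n} {x : Fin n} → (Q ∖ v ∖ u) x ≡ true → x ≢ u × x ≢ v
  off-pair {Q} {x} Q′x = ∖-≢ (Q ∖ v) u x Q′x , ∖-≢ Q v x (∖-⊆ (Q ∖ v) u x Q′x)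

  rowSum-twin-split : (U : SubsetF n) (c : Fin n) →
    rowSum A U c ≡ (rowSum A (U ∖ u ∖ v) c xor (U v ∧ A v c)) xor (U u ∧ A u c)
  rowSum-twin-split U c = begin
    rowSum A U c
      ≡⟨ sum₂-∩-split U u (λ i → A i c) ⟩
    rowSum A (U ∖ u) c xor (U u ∧ A u c)
      ≡⟨ cong (_xor (U u ∧ A u c)) (sum₂-∩-split (U ∖ u) v (λ i → A i c)) ⟩
    (rowSum A (U ∖ u ∖ v) c xor ((U ∖ u) v ∧ A v c)) xor (U u ∧ A u c)
      ≡⟨ cong (λ x → (rowSum A (U ∖ u ∖ v) c xor (x ∧ A v c)) xor (U u ∧ A u c)) Uv ⟩
    (rowSum A (U ∖ u ∖ v) c xor (U v ∧ A v c)) xor (U u ∧ A u c)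
      ∎
    where
    open ≡-Reasoning
    Uv : (U ∖ u) v ≡ U v
    Uv = trans (cong (λ x → U v ∧ not x) (≢⇒==-false (u≢v ∘ sym))) (∧-identityʳ (U v))

  rowSum-twin-columns : (V : SubsetF n) → (∀ x → V x ≡ true → x ≢ u × x ≢ v) → rowSum A V u ≡ rowSum A V v
  rowSum-twin-columns V off = sum₂-∩-congʳ V (λ x Vx → twin-columns (proj₁ (off x Vx)) (proj₂ (off x Vx)))

  twins-independent : {Q T′ : SubsetF n} → Q u ≡ true → Q v ≡ true → T′ ⊆ Q ∖ v ∖ u →
    IndependentOn A (Q ∖ v ∖ u) T′ → IndependentOn A Q (T′ ∪⁅ v ⁆ ∪⁅ u ⁆)
  -- Columns u and v of a dependency U force U u ≡ U v; rows u and v then cancel off {u, v},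
  -- leaving a dependency among the rows of T′ that must be empty.
  twins-independent {Q} {T′} Qu Qv T′⊆Q′ indep′ U U⊆T (i , Ui) vanish = by-cases (nonempty? V)
    where
    V = U ∖ u ∖ v
    V⊆T′ : V ⊆ T′
    V⊆T′ = ∖-⊆-∪⁅⁆ (∖-⊆-∪⁅⁆ U⊆T)
    rV = rowSum A V
    column-u : rowSum A U u ≡ rV u xor U v
    column-u = begin
      rowSum A U u                                    ≡⟨ rowSum-twin-split U u ⟩
      (rV u xor (U v ∧ A v u)) xor (U u ∧ A u u)      ≡⟨ cong₂ (λ x y → (rV u xor (U v ∧ x)) xor (U u ∧ y)) A-vu A-uu ⟩
      (rV u xor (U v ∧ true)) xor (U u ∧ false)       ≡⟨ cong₂ (λ x y → (rV u xor x) xor y) (∧-identityʳ (U v)) (∧-zeroʳ (U u)) ⟩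
      (rV u xor U v) xor false                        ≡⟨ xor-identityʳ (rV u xor U v) ⟩
      rV u xor U v                                    ∎
      where open ≡-Reasoning
    column-v : rowSum A U v ≡ rV v xor U u
    column-v = begin
      rowSum A U v                                    ≡⟨ rowSum-twin-split U v ⟩
      (rV v xor (U v ∧ A v v)) xor (U u ∧ A u v)      ≡⟨ cong₂ (λ x y → (rV v xor (U v ∧ x)) xor (U u ∧ y)) A-vv A-uv ⟩
      (rV v xor (U v ∧ false)) xor (U u ∧ true)       ≡⟨ cong₂ (λ x y → (rV v xor x) xor y) (∧-zeroʳ (U v)) (∧-identityʳ (U u)) ⟩
      (rV v xor false) xor U u                        ≡⟨ cong (_xor U u) (xor-identityʳ (rV v)) ⟩
      rV v xor U u                                    ∎
      where open ≡-Reasoning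
    Uv≡rV : U v ≡ rV u
    Uv≡rV = sym (xor≡false⇒≡ (trans (sym column-u) (vanish u Qu)))
    Uu≡rV : U u ≡ rV u
    Uu≡rV = trans (sym (xor≡false⇒≡ (trans (sym column-v) (vanish v Qv))))
                  (sym (rowSum-twin-columns V (λ x Vx → off-pair {Q} (T′⊆Q′ x (V⊆T′ x Vx)))))
    vanishV : VanishesOn (Q ∖ v ∖ u) rV
    vanishV c Q′c = begin
      rV c                                                ≡⟨ sym (xor-cancelʳ (rV c) (U u ∧ A u c)) ⟩
      (rV c xor (U u ∧ A u c)) xor (U u ∧ A u c)          ≡⟨ cong₂ (λ x y → (rV c xor (x ∧ y)) xor (U u ∧ A u c))
                                                                (trans Uu≡rV (sym Uv≡rV)) (twin-rows c≢u c≢v) ⟩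
      (rV c xor (U v ∧ A v c)) xor (U u ∧ A u c)          ≡⟨ sym (rowSum-twin-split U c) ⟩
      rowSum A U c                                        ≡⟨ vanish c (∖-⊆ Q v c (∖-⊆ (Q ∖ v) u c Q′c)) ⟩
      false                                               ∎
      where
      open ≡-Reasoning
      c≢u = proj₁ (off-pair {Q} Q′c)
      c≢v = proj₂ (off-pair {Q} Q′c)
    by-cases : Dec (Nonempty V) → ⊥
    by-cases (yes neV) = indep′ V V⊆T′ neV vanishV
    by-cases (no ¬neV) = Bool.not-¬ Ui (∖∖≗∅ (¬Nonempty⇒≗∅ ¬neV) U-u U-v i)
      where
      rV≡false = sum₂-∅∩ (¬Nonempty⇒≗∅ ¬neV) (λ j → A j u)
      U-u = trans Uu≡rV rV≡false
      U-v = trans Uv≡rV rV≡false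

  twins-spans : {Q T′ : SubsetF n} → T′ ⊆ Q ∖ v ∖ u →
    (∀ {s} → (Q ∖ v ∖ u) s ≡ true → InSpanOn (Q ∖ v ∖ u) A T′ (A s)) →
    ∀ {s} → Q s ≡ true → InSpanOn Q A (T′ ∪⁅ v ⁆ ∪⁅ u ⁆) (A s)
  twins-spans {Q} {T′} T′⊆Q′ spans′ {s} Qs with s ≟ u | s ≟ v
  ... | yes refl | _        = InSpanOn-row Q A Tu
    where Tu = ∪⁅⁆-∋ (T′ ∪⁅ v ⁆) u
  ... | no _     | yes refl = InSpanOn-row Q A Tv
    where Tv = ∪⁅⁆-⊇ (T′ ∪⁅ v ⁆) u v (∪⁅⁆-∋ T′ v)
  ... | no s≢u   | no s≢v   = W , W⊆T , λ c Qc → sym (trans (rowSum-W c) (value c Qc))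
    where
    T = T′ ∪⁅ v ⁆ ∪⁅ u ⁆
    Q′s = ∖-∈ {U = Q ∖ v} (∖-∈ {U = Q} Qs s≢v) s≢u
    V = proj₁ (spans′ Q′s)
    rV = rowSum A V
    -- Row u + row v vanishes off {u, v} and is 1 at u and v; γ of it fixes V in those two columns.
    γ = A s u xor rV u
    W = V ⊕ γ · (⁅ u ⁆ ⊕ ⁅ v ⁆)
    V⊆T′ = proj₁ (proj₂ (spans′ Q′s))
    W⊆T : W ⊆ T
    W⊆T = ⊕·-⊆ {P = T} γ (λ i Vi → ∪⁅⁆-⊇ (T′ ∪⁅ v ⁆) u i (∪⁅⁆-⊇ T′ v i (V⊆T′ i Vi)))
                 (⊕·-⊆ true (⁅⁆-⊆ (∪⁅⁆-∋ (T′ ∪⁅ v ⁆) u)) (⁅⁆-⊆ (∪⁅⁆-⊇ (T′ ∪⁅ v ⁆) u v (∪⁅⁆-∋ T′ v))))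
    rowSum-W : ∀ c → rowSum A W c ≡ rV c xor (γ ∧ (A u c xor A v c))
    rowSum-W c = begin
      rowSum A W c                                              ≡⟨ sum₂-⊕∩ V _ (λ i → A i c) ⟩
      rV c xor sum₂ ((γ · (⁅ u ⁆ ⊕ ⁅ v ⁆)) ∩ (λ i → A i c))      ≡⟨ cong (rV c xor_) (sum₂-·∩ γ (⁅ u ⁆ ⊕ ⁅ v ⁆) (λ i → A i c)) ⟩
      rV c xor (γ ∧ rowSum A (⁅ u ⁆ ⊕ ⁅ v ⁆) c)                   ≡⟨ cong (λ x → rV c xor (γ ∧ x)) (sum₂-⊕∩ ⁅ u ⁆ ⁅ v ⁆ (λ i → A i c)) ⟩
      rV c xor (γ ∧ (rowSum A ⁅ u ⁆ c xor rowSum A ⁅ v ⁆ c))      ≡⟨ cong₂ (λ x y → rV c xor (γ ∧ (x xor y))) (rowSum-⁅⁆ A u c) (rowSum-⁅⁆ A v c) ⟩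
      rV c xor (γ ∧ (A u c xor A v c))                          ∎
      where open ≡-Reasoning
    value : ∀ c → Q c ≡ true → rV c xor (γ ∧ (A u c xor A v c)) ≡ A s c
    value c Qc with c ≟ u | c ≟ v
    ... | yes refl | _ = begin
      rV u xor (γ ∧ (A u u xor A v u))    ≡⟨ cong (λ x → rV u xor (γ ∧ x)) (cong₂ _xor_ A-uu A-vu) ⟩
      rV u xor (γ ∧ true)                 ≡⟨ cong (rV u xor_) (∧-identityʳ γ) ⟩
      rV u xor (A s u xor rV u)           ≡⟨ xor-restore (A s u) (rV u) ⟩
      A s u                               ∎
      where open ≡-Reasoning
    ... | no _ | yes refl = begin
      rV v xor (γ ∧ (A u v xor A v v))    ≡⟨ cong₂ (λ x y → x xor (γ ∧ y)) (sym rV-uv) (cong₂ _xor_ A-uv A-vv) ⟩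
      rV u xor (γ ∧ true)                 ≡⟨ cong (rV u xor_) (∧-identityʳ γ) ⟩
      rV u xor (A s u xor rV u)           ≡⟨ xor-restore (A s u) (rV u) ⟩
      A s u                               ≡⟨ twin-columns s≢u s≢v ⟩
      A s v                               ∎
      where
      open ≡-Reasoning
      rV-uv = rowSum-twin-columns V (λ x Vx → off-pair {Q} (T′⊆Q′ x (V⊆T′ x Vx)))
    ... | no c≢u | no c≢v = begin
      rV c xor (γ ∧ (A u c xor A v c))    ≡⟨ cong (λ x → rV c xor (γ ∧ x)) pair-cancels ⟩
      rV c xor (γ ∧ false)                ≡⟨ trans (cong (rV c xor_) (∧-zeroʳ γ)) (xor-identityʳ (rV c)) ⟩
      rV c                                ≡⟨ sym (proj₂ (proj₂ (spans′ Q′s)) c (∖-∈ {U = Q ∖ v} (∖-∈ {U = Q} Qc c≢v) c≢u)) ⟩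
      A s c                               ∎
      where
      open ≡-Reasoning
      pair-cancels = trans (cong (_xor A v c) (twin-rows c≢u c≢v)) (xor-same (A v c))

  HasRank-twins : {Q : SubsetF n} {d : ℕ} → Q u ≡ true → Q v ≡ true →
    HasRank A (Q ∖ v ∖ u) d → HasRank A Q (suc (suc d))
  HasRank-twins {Q} Qu Qv ((T′ , (T′⊆Q′ , indep′) , refl) , maximal′) =
    (T , (T⊆Q , twins-independent Qu Qv T′⊆Q′ indep′) , card-T) , λ S (S⊆Q , indepS) →
      subst (card S ≤_) card-T (steinitz Q A T A S (λ s Ss → spans (S⊆Q s Ss)) indepS)
    where
    T = T′ ∪⁅ v ⁆ ∪⁅ u ⁆
    T⊆Q : T ⊆ Q
    T⊆Q = ∪⁅⁆-⊆ (∪⁅⁆-⊆ (λ i T′i → ∖-⊆ Q v i (∖-⊆ (Q ∖ v) u i (T′⊆Q′ i T′i))) Qv) Qu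
    T′u : T′ u ≡ false
    T′u = Bool.¬-not (λ T′u → proj₁ (off-pair {Q} (T′⊆Q′ u T′u)) refl)
    T′v : T′ v ≡ false
    T′v = Bool.¬-not (λ T′v → proj₂ (off-pair {Q} (T′⊆Q′ v T′v)) refl)
    card-T : card T ≡ suc (suc (card T′))
    card-T = trans (card-∪⁅⁆ (T′ ∪⁅ v ⁆) u (cong₂ _∨_ T′u (≢⇒==-false u≢v)))
                   (cong suc (card-∪⁅⁆ T′ v T′v))
    spans : ∀ {s} → Q s ≡ true → InSpanOn Q A T (A s)
    spans = twins-spans T′⊆Q′ (maximum-spans (T′⊆Q′ , indep′) maximal′)

HasRank-twin-matching : (G : Graph n) (M : EdgeList n) → Unique (coveredVertices M) →
  All (λ e → AdjacentTwins G (proj₁ e) (proj₂ e)) M → {d : ℕ} →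
  HasRank (adj G) (avoiding (coveredVertices M)) d → HasRank (adj G) full (2 * length M + d)
HasRank-twin-matching G []            _                              []                rank = rank
HasRank-twin-matching G ((u , v) ∷ M) ((u≢v ∷ u∉M) ∷ v∉M ∷ unique) (twins ∷ twins-M) {d} rank =
  subst (HasRank (adj G) full) (2k+[2+d]≡2[1+k]+d (length M))
    (HasRank-twin-matching G M unique twins-M
      (TwinPair.HasRank-twins G u≢v twins (avoiding-∉ X u∉M) (avoiding-∉ X v∉M)
        (HasRank-cong avoiding-uv rank)))
  where
  X = coveredVertices M
  avoiding-uv : avoiding (u ∷ v ∷ X) ≗ avoiding X ∖ v ∖ u
  avoiding-uv x = trans (avoiding-∷ u (v ∷ X) x) (cong (λ b → b ∧ not (x == u)) (avoiding-∷ v X x))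
  2k+[2+d]≡2[1+k]+d : ∀ k → 2 * k + suc (suc d) ≡ 2 * suc k + d
  2k+[2+d]≡2[1+k]+d k =
    trans (+-suc (2 * k) (suc d)) (trans (cong suc (+-suc (2 * k) d)) (cong (_+ d) (sym (*-suc 2 k))))

lemma6p1 : (n : ℕ) (G : Graph n) (M : EdgeList n) →
    IsMatching G M →
    All (λ e → AdjacentTwins G (proj₁ e) (proj₂ e)) M →
    r₂ G ≡ 2 * length M + r₂ (deleteVertices G (coveredVertices M))
lemma6p1 n G M (_ , unique) twins =
  HasRank-unique (rank₂-HasRank (adj G))
    (HasRank-twin-matching G M unique twins
      (HasRank-enumeration (remaining-Enumeration X) (rank₂-HasRank (adj (deleteVertices G X)))))
  where
  X = coveredVertices M
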